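{- Let $G$ and $G'$ be finite groups with chains of subgroups $\mathcal{C}:\ \{e\}\ne H_1\subsetneq H_2\subsetneq\dots\subsetneq H_n=G$ and $\mathcal{C}':\ \{e\}\ne H_1'\subsetneq H_2'\subsetneq\dots\subsetneq H_n'=G'$. If $|H_i|=|H_i'|$ for all $1\le i\le n$, then $(G,d_{\mathcal{C}})$ and $(G',d_{\mathcal{C}'})$ are isometric.
   Context: For a chain of subgroups $H_1\subsetneq\dots\subsetneq H_n=G$ of a group $G$, set $H_0=\{e\}$ and $H_{ -1}=\varnothing$; the chain metric is $d_{\mathcal{C}}(x,y)=i$ if $xy^{ -1}\in H_i\setminus H_{i-1}$, for $i=0,\dots,n$ (in additive notation, $x-y\in H_i\setminus H_{i-1}$). An isometry is a distance-preserving bijection. -}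

module Defs where

open import Level using (Level; _⊔_)
open import Algebra.Bundles using (Group)
open import Data.Nat using (ℕ; zero; suc; _≤_; _<_)
open import Data.Fin using (Fin)
open import Data.Product using (Σ; _×_; ∃; proj₁)
open import Relation.Nullary using (¬_)
open import Relation.Unary using (Pred; _⊆_)
open import Relation.Binary.Bundles using (Setoid)
import Relation.Binary.PropositionalEquality as ≡
open import Function.Bundles using (Bijection; _⇔_)

module _ {c ℓ : Level} (G : Group c ℓ) where
  open Group G

  record IsSubgroup {p : Level} (P : Pred Carrier p) : Set (c ⊔ ℓ ⊔ p) where
    field
      resp  : ∀ {x y} → x ≈ y → P x → P y
      ε∈    : P ε
      ∙-closed : ∀ {x y} → P x → P y → P (x ∙ y)
      ⁻¹-closed : ∀ {x} → P x → P (x ⁻¹)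

  subSetoid : {p : Level} → Pred Carrier p → Setoid (c ⊔ p) ℓ
  subSetoid P = record
    { Carrier = Σ Carrier P
    ; _≈_ = λ a b → proj₁ a ≈ proj₁ b
    ; isEquivalence = record { refl = refl ; sym = sym ; trans = trans } }

  HasCard : {p : Level} → Pred Carrier p → ℕ → Set (c ⊔ ℓ ⊔ p)
  HasCard P k = Bijection (≡.setoid (Fin k)) (subSetoid P)

  IsFinite : Set (c ⊔ ℓ)
  IsFinite = ∃ λ m → Bijection (≡.setoid (Fin m)) setoid

  -- A chain {e} ≠ H₁ ⊊ H₂ ⊊ ... ⊊ Hₙ = G of subgroups, indexed by 1..n
  -- (values of H outside 1..n are irrelevant).
  record Chain (p : Level) (n : ℕ) : Set (c ⊔ ℓ ⊔ Level.suc p) where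
    field
      H        : ℕ → Pred Carrier p
      1≤n      : 1 ≤ n
      subgroup : ∀ i → 1 ≤ i → i ≤ n → IsSubgroup (H i)
      incl     : ∀ i → 1 ≤ i → i < n → H i ⊆ H (suc i)
      strict   : ∀ i → 1 ≤ i → i < n → ∃ λ x → H (suc i) x × ¬ H i x
      top      : ∀ x → H n x
      nontriv  : ∃ λ x → H 1 x × ¬ (x ≈ ε)

    Lvl : ℕ → Pred Carrier (ℓ ⊔ p)
    Lvl zero    x = Level.Lift p (x ≈ ε)
    Lvl (suc i) x = Level.Lift ℓ (H (suc i) x)

    -- d_C(x,y) = i  iff  x y⁻¹ ∈ Hᵢ \ Hᵢ₋₁  (with H₋₁ = ∅), 0 ≤ i ≤ n
    Dist : Carrier → Carrier → ℕ → Set (ℓ ⊔ p)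
    Dist x y zero    = Lvl zero (x ∙ y ⁻¹)
    Dist x y (suc i) = Level.Lift (ℓ ⊔ p) (suc i ≤ n) × Lvl (suc i) (x ∙ y ⁻¹) × ¬ Lvl i (x ∙ y ⁻¹)

open Chain public using (Dist)

Isometric : ∀ {c ℓ c' ℓ' p p'} {n : ℕ} (G : Group c ℓ) (G' : Group c' ℓ')
  → Chain G p n → Chain G' p' n → Set _
Isometric G G' C C' =
  Σ (Bijection (Group.setoid G) (Group.setoid G')) λ f →
    ∀ x y i → Dist C x y i ⇔ Dist C' (Bijection.to f x) (Bijection.to f y) i

module Submission where

-- The chain metric is an ultrametric whose closed balls of radius i are the cosets H_i x, so every
-- ball of radius i has |H_i| elements. Finite ultrametric spaces in which, for each radius, all balls
-- have the same size and these sizes agree are isometric: pick x and y, match the ball of radius m − 1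
-- around x with the one around y, match the complements, and note that a point inside and a point
-- outside such a ball are at distance exactly m in both spaces. Enumerating G and G' turns the groups
-- into lists to which this recursion applies.

open import Level using (Level; _⊔_; Lift; lift; lower) renaming (suc to lsuc)
open import Algebra.Bundles using (Group)
import Algebra.Properties.Group as GroupProperties
open import Data.Empty using (⊥-elim)
open import Data.Nat using (ℕ; zero; suc; _≤_; _<_; _≤′_; ≤′-refl; ≤′-step; _+_; _⊓_; z≤n; s≤s)
open import Data.Nat.Properties
  using (≤-refl; ≤-trans; ≤-pred; ≤⇒≤′; _<?_; ≮⇒≥; <⇒≤; m<n⇒m<1+n; n≤1+n; +-suc; +-cancelˡ-≡;
         m⊓n≤n; m≤n⇒m⊓n≡m; ⊓-monoˡ-≤)
open import Data.Fin using (Fin)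
open import Data.Fin.Properties using (any?; inj⇒≟)
open import Data.List using (List; []; _∷_; length; filter; map; allFin)
open import Data.List.Properties
  using (filter-accept; filter-reject; filter-all; filter-notAll; length-filter;
         length-map; length-tabulate)
open import Data.List.Membership.Propositional using (_∈_)
open import Data.List.Membership.Propositional.Properties
  using (∈-filter⁺; ∈-filter⁻; ∈-map⁺; ∈-map⁻; ∈-allFin)
open import Data.List.Membership.Propositional.Properties.WithK using (unique∧set⇒bag)
open import Data.List.Relation.Binary.BagAndSetEquality using (∼bag⇒↭)
open import Data.List.Relation.Binary.Permutation.Propositional.Properties using (↭-length)
import Data.List.Relation.Unary.All as All
open import Data.List.Relation.Unary.Any as Any using (here)
import Data.List.Relation.Unary.Unique.Propositional.Properties as Unique
open import Data.Product using (Σ; ∃; _×_; _,_; proj₁; proj₂)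
open import Function.Base using (id; _∘_; _$_)
open import Function.Bundles using (Bijection; Inverse; Equivalence; _⇔_; mk⇔; _↔_; mk↔ₛ′)
open import Function.Definitions using (Injective)
open import Function.Properties.Bijection using (Bijection⇒Inverse)
open import Function.Properties.Inverse using (Inverse⇒Injection; Inverse⇒Bijection)
import Function.Properties.Equivalence as ⇔
import Function.Construct.Composition as Composition
import Function.Construct.Symmetry as Symmetry
open import Relation.Binary.Core using (Rel)
open import Relation.Binary.Structures using (IsEquivalence; IsDecEquivalence)
import Relation.Binary.Construct.On as On
import Relation.Binary.PropositionalEquality as ≡
open ≡ using (_≡_)
open import Relation.Nullary using (¬_; Dec; yes; no)
import Relation.Nullary.Decidable as Dec
open import Relation.Unary using (Pred; Decidable; _⊆_)
open import Relation.Unary.Properties using (∁?)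

open import Defs

module _ {a} {A : Set a} where

  filter-⊆-filter : ∀ {p q} {P : Pred A p} {Q : Pred A q} (P? : Decidable P) (Q? : Decidable Q) →
    P ⊆ Q → ∀ xs → filter P? (filter Q? xs) ≡ filter P? xs
  filter-⊆-filter P? Q? P⊆Q [] = ≡.refl
  filter-⊆-filter P? Q? P⊆Q (x ∷ xs) with Q? x | P? x
  ... | yes _ | yes px = ≡.trans (filter-accept P? px) (≡.cong (x ∷_) (filter-⊆-filter P? Q? P⊆Q xs))
  ... | yes _ | no ¬px = ≡.trans (filter-reject P? ¬px) (filter-⊆-filter P? Q? P⊆Q xs)
  ... | no ¬qx | yes px = ⊥-elim (¬qx (P⊆Q px))
  ... | no _ | no _ = filter-⊆-filter P? Q? P⊆Q xs

  length-filter+length-filter-∁ : ∀ {p} {P : Pred A p} (P? : Decidable P) xs →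
    length (filter P? xs) + length (filter (∁? P?) xs) ≡ length xs
  length-filter+length-filter-∁ P? [] = ≡.refl
  length-filter+length-filter-∁ P? (x ∷ xs) with P? x
  ... | yes _ = ≡.cong suc (length-filter+length-filter-∁ P? xs)
  ... | no _ = ≡.trans (+-suc _ _) (≡.cong suc (length-filter+length-filter-∁ P? xs))

length-filter-allFin : ∀ {m k q} {Q : Pred (Fin m) q} (Q? : Decidable Q) (φ : Fin k → Fin m) →
  Injective _≡_ _≡_ φ → (∀ {v} → Q v ⇔ ∃ λ c → φ c ≡ v) → length (filter Q? (allFin m)) ≡ k
length-filter-allFin {m} {k} Q? φ φ-inj Q⇔image = begin
  length (filter Q? (allFin m)) ≡⟨ ↭-length (∼bag⇒↭ (unique∧set⇒bag
                                      (Unique.filter⁺ Q? (Unique.allFin⁺ m))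
                                      (Unique.map⁺ φ-inj (Unique.allFin⁺ k))
                                      (mk⇔ filter⊆image image⊆filter))) ⟩
  length (map φ (allFin k))     ≡⟨ length-map φ (allFin k) ⟩
  length (allFin k)             ≡⟨ length-tabulate id ⟩
  k                             ∎
  where
  open ≡.≡-Reasoning
  filter⊆image : ∀ {v} → v ∈ filter Q? (allFin m) → v ∈ map φ (allFin k)
  filter⊆image v∈ with c , ≡.refl ← Equivalence.to Q⇔image (proj₂ (∈-filter⁻ Q? {xs = allFin m} v∈)) =
    ∈-map⁺ φ (∈-allFin c)
  image⊆filter : ∀ {v} → v ∈ map φ (allFin k) → v ∈ filter Q? (allFin m)
  image⊆filter v∈ with c , _ , ≡.refl ← ∈-map⁻ φ v∈ =
    ∈-filter⁺ Q? (∈-allFin (φ c)) (Equivalence.from Q⇔image (c , ≡.refl))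

-- A ℕ-valued ultrametric given by its closed balls: Within i x y reads d(x, y) ≤ i.
record Tower {a} (A : Set a) (r : Level) : Set (a ⊔ lsuc r) where
  field
    Within           : ℕ → Rel A r
    isDecEquivalence : ∀ i → IsDecEquivalence (Within i)
    within-suc       : ∀ i {x y} → Within i x y → Within (suc i) x y
    within-0⇒≡       : ∀ {x y} → Within 0 x y → x ≡ y

module TowerProperties {a r} {A : Set a} (T : Tower A r) where
  open Tower T public

  module _ (i : ℕ) where
    open IsDecEquivalence (isDecEquivalence i) public
      renaming (refl to within-refl; sym to within-sym; trans to within-trans; _≟_ to within?)

  within-sym⇔ : ∀ i {x y} → Within i x y ⇔ Within i y x
  within-sym⇔ i = mk⇔ (within-sym i) (within-sym i)

  within-≤ : ∀ {i j x y} → i ≤ j → Within i x y → Within j x y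
  within-≤ {i} {x = x} {y} i≤j w = go (≤⇒≤′ i≤j)
    where
    go : ∀ {j} → i ≤′ j → Within j x y
    go ≤′-refl = w
    go (≤′-step i≤′j) = within-suc _ (go i≤′j)

  within⇔< : ∀ {m x y} → ¬ Within m x y → Within (suc m) x y → ∀ i → Within i x y ⇔ m < i
  within⇔< {m} ¬w w i = mk⇔ from-within (λ m<i → within-≤ m<i w)
    where
    from-within : Within i _ _ → m < i
    from-within wi with m <? i
    ... | yes m<i = m<i
    ... | no m≮i = ⊥-elim (¬w (within-≤ (≮⇒≥ m≮i) wi))

  ball : ℕ → A → List A → List A
  ball m x = filter (within? m x)

  outside : ℕ → A → List A → List A
  outside m x = filter (∁? (within? m x))

  size : ℕ → A → List A → ℕ
  size m x X = length (ball m x X)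

  Diam≤ : ℕ → List A → Set (a ⊔ r)
  Diam≤ m X = ∀ {u v} → u ∈ X → v ∈ X → Within m u v

  diam≤-ball : ∀ m x X → Diam≤ m (ball m x X)
  diam≤-ball m x X u∈ v∈ =
    within-trans m (within-sym m (proj₂ (∈-filter⁻ (within? m x) {xs = X} u∈)))
                   (proj₂ (∈-filter⁻ (within? m x) {xs = X} v∈))

  diam≤-filter : ∀ {p m X} {P : Pred A p} (P? : Decidable P) → Diam≤ m X → Diam≤ m (filter P? X)
  diam≤-filter {X = X} P? d u∈ v∈ =
    d (proj₁ (∈-filter⁻ P? {xs = X} u∈)) (proj₁ (∈-filter⁻ P? {xs = X} v∈))

  across⇔< : ∀ {m x w w' X} → Diam≤ (suc m) X → w ∈ X → w' ∈ X →
    Within m x w → ¬ Within m x w' → ∀ i → Within i w w' ⇔ m < i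
  across⇔< {m} d w∈ w'∈ xw ¬xw' =
    within⇔< (λ ww' → ¬xw' (within-trans m xw ww')) (d w∈ w'∈)

  size-diam≤ : ∀ {m x X} → Diam≤ m X → x ∈ X → size m x X ≡ length X
  size-diam≤ {m} {x} {X} d x∈ = ≡.cong length (filter-all (within? m x) (All.tabulate (d x∈)))

  size-ball : ∀ {j m x u} X → j ≤ m → u ∈ ball m x X → size j u (ball m x X) ≡ size j u X
  size-ball {j} {m} {x} {u} X j≤m u∈ = ≡.cong length $
    filter-⊆-filter (within? j u) (within? m x)
      (λ uw → within-trans m (proj₂ (∈-filter⁻ (within? m x) {xs = X} u∈)) (within-≤ j≤m uw)) X

  size-outside : ∀ {j m x u} X → j ≤ m → u ∈ outside m x X → size j u (outside m x X) ≡ size j u X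
  size-outside {j} {m} {x} {u} X j≤m u∈ = ≡.cong length $
    filter-⊆-filter (within? j u) (∁? (within? m x))
      (λ uw xw → proj₂ (∈-filter⁻ (∁? (within? m x)) {xs = X} u∈)
                   (within-trans m xw (within-sym m (within-≤ j≤m uw)))) X

  length-ball+outside : ∀ m x X → length (ball m x X) + length (outside m x X) ≡ length X
  length-ball+outside m x = length-filter+length-filter-∁ (within? m x)

  length-outside< : ∀ {m x X} → x ∈ X → length (outside m x X) < length X
  length-outside< {m} {x} {X} x∈ =
    filter-notAll (∁? (within? m x)) X (Any.map (λ { ≡.refl ¬w → ¬w (within-refl m) }) x∈)

module _ {a b r s} {A : Set a} {B : Set b} (TA : Tower A r) (TB : Tower B s) where
  private
    module A = TowerProperties TA
    module B = TowerProperties TB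

  record ListIsometry (X : List A) (Y : List B) : Set (a ⊔ b ⊔ r ⊔ s) where
    field
      to          : A → B
      from        : B → A
      to-∈        : ∀ {w} → w ∈ X → to w ∈ Y
      from-∈      : ∀ {z} → z ∈ Y → from z ∈ X
      from-to     : ∀ {w} → w ∈ X → from (to w) ≡ w
      to-from     : ∀ {z} → z ∈ Y → to (from z) ≡ z
      within-pres : ∀ {w w'} → w ∈ X → w' ∈ X → ∀ i → A.Within i w w' ⇔ B.Within i (to w) (to w')

  glue : ∀ {p q} {P : Pred A p} {Q : Pred B q} (P? : Decidable P) (Q? : Decidable Q) {X Y} →
    (∀ {w w' z z'} → w ∈ X → P w → w' ∈ X → ¬ P w' → z ∈ Y → Q z → z' ∈ Y → ¬ Q z' →
       ∀ i → A.Within i w w' ⇔ B.Within i z z') →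
    ListIsometry (filter P? X) (filter Q? Y) →
    ListIsometry (filter (∁? P?) X) (filter (∁? Q?) Y) →
    ListIsometry X Y
  glue {P = P} {Q} P? Q? {X} {Y} cross I J = record
    { to = to ; from = from ; to-∈ = to-∈ ; from-∈ = from-∈
    ; from-to = from-to ; to-from = to-from ; within-pres = within-pres }
    where
    module I = ListIsometry I
    module J = ListIsometry J

    I-to : ∀ {w} → w ∈ X → P w → I.to w ∈ Y × Q (I.to w)
    I-to w∈ pw = ∈-filter⁻ Q? (I.to-∈ (∈-filter⁺ P? w∈ pw))

    J-to : ∀ {w} → w ∈ X → ¬ P w → J.to w ∈ Y × ¬ Q (J.to w)
    J-to w∈ ¬pw = ∈-filter⁻ (∁? Q?) (J.to-∈ (∈-filter⁺ (∁? P?) w∈ ¬pw))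

    I-from : ∀ {z} → z ∈ Y → Q z → I.from z ∈ X × P (I.from z)
    I-from z∈ qz = ∈-filter⁻ P? (I.from-∈ (∈-filter⁺ Q? z∈ qz))

    J-from : ∀ {z} → z ∈ Y → ¬ Q z → J.from z ∈ X × ¬ P (J.from z)
    J-from z∈ ¬qz = ∈-filter⁻ (∁? P?) (J.from-∈ (∈-filter⁺ (∁? Q?) z∈ ¬qz))

    to : A → B
    to w with P? w
    ... | yes _ = I.to w
    ... | no _  = J.to w

    from : B → A
    from z with Q? z
    ... | yes _ = I.from z
    ... | no _  = J.from z

    to-∈ : ∀ {w} → w ∈ X → to w ∈ Y
    to-∈ {w} w∈ with P? w
    ... | yes pw = proj₁ (I-to w∈ pw)
    ... | no ¬pw = proj₁ (J-to w∈ ¬pw)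

    from-∈ : ∀ {z} → z ∈ Y → from z ∈ X
    from-∈ {z} z∈ with Q? z
    ... | yes qz = proj₁ (I-from z∈ qz)
    ... | no ¬qz = proj₁ (J-from z∈ ¬qz)

    from-to : ∀ {w} → w ∈ X → from (to w) ≡ w
    from-to {w} w∈ with P? w
    ... | yes pw with Q? (I.to w)
    ...   | yes _ = I.from-to (∈-filter⁺ P? w∈ pw)
    ...   | no ¬q = ⊥-elim (¬q (proj₂ (I-to w∈ pw)))
    from-to {w} w∈ | no ¬pw with Q? (J.to w)
    ...   | yes q = ⊥-elim (proj₂ (J-to w∈ ¬pw) q)
    ...   | no _  = J.from-to (∈-filter⁺ (∁? P?) w∈ ¬pw)

    to-from : ∀ {z} → z ∈ Y → to (from z) ≡ z
    to-from {z} z∈ with Q? z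
    ... | yes qz with P? (I.from z)
    ...   | yes _ = I.to-from (∈-filter⁺ Q? z∈ qz)
    ...   | no ¬p = ⊥-elim (¬p (proj₂ (I-from z∈ qz)))
    to-from {z} z∈ | no ¬qz with P? (J.from z)
    ...   | yes p = ⊥-elim (proj₂ (J-from z∈ ¬qz) p)
    ...   | no _  = J.to-from (∈-filter⁺ (∁? Q?) z∈ ¬qz)

    within-pres : ∀ {w w'} → w ∈ X → w' ∈ X → ∀ i → A.Within i w w' ⇔ B.Within i (to w) (to w')
    within-pres {w} {w'} w∈ w'∈ i with P? w | P? w'
    ... | yes pw | yes pw' = I.within-pres (∈-filter⁺ P? w∈ pw) (∈-filter⁺ P? w'∈ pw') i
    ... | no ¬pw | no ¬pw' = J.within-pres (∈-filter⁺ (∁? P?) w∈ ¬pw) (∈-filter⁺ (∁? P?) w'∈ ¬pw') i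
    ... | yes pw | no ¬pw' =
      let z∈ , qz = I-to w∈ pw ; z'∈ , ¬qz' = J-to w'∈ ¬pw'
      in cross w∈ pw w'∈ ¬pw' z∈ qz z'∈ ¬qz' i
    ... | no ¬pw | yes pw' =
      let z∈ , ¬qz = J-to w∈ ¬pw ; z'∈ , qz' = I-to w'∈ pw'
      in ⇔.trans (A.within-sym⇔ i) (⇔.trans (cross w'∈ pw' w∈ ¬pw z'∈ qz' z∈ ¬qz i) (B.within-sym⇔ i))

  SameSizes : ℕ → List A → List B → Set (a ⊔ b)
  SameSizes m X Y = ∀ j → j < m → ∀ {u v} → u ∈ X → v ∈ Y → A.size j u X ≡ B.size j v Y

  sameSizes-ball : ∀ {m x y X Y} → SameSizes (suc m) X Y → SameSizes m (A.ball m x X) (B.ball m y Y)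
  sameSizes-ball {m} {x} {y} {X} {Y} same j j<m {u} {v} u∈ v∈ = begin
    A.size j u (A.ball m x X) ≡⟨ A.size-ball X (<⇒≤ j<m) u∈ ⟩
    A.size j u X              ≡⟨ same j (m<n⇒m<1+n j<m) (proj₁ (∈-filter⁻ (A.within? m x) {xs = X} u∈))
                                                        (proj₁ (∈-filter⁻ (B.within? m y) {xs = Y} v∈)) ⟩
    B.size j v Y              ≡⟨ B.size-ball Y (<⇒≤ j<m) v∈ ⟨
    B.size j v (B.ball m y Y) ∎
    where open ≡.≡-Reasoning

  sameSizes-outside : ∀ {m x y X Y} → SameSizes (suc m) X Y →
    SameSizes (suc m) (A.outside m x X) (B.outside m y Y)
  sameSizes-outside {m} {x} {y} {X} {Y} same j j<1+m {u} {v} u∈ v∈ = begin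
    A.size j u (A.outside m x X) ≡⟨ A.size-outside X (≤-pred j<1+m) u∈ ⟩
    A.size j u X                 ≡⟨ same j j<1+m (proj₁ (∈-filter⁻ (∁? (A.within? m x)) {xs = X} u∈))
                                                 (proj₁ (∈-filter⁻ (∁? (B.within? m y)) {xs = Y} v∈)) ⟩
    B.size j v Y                 ≡⟨ B.size-outside Y (≤-pred j<1+m) v∈ ⟨
    B.size j v (B.outside m y Y) ∎
    where open ≡.≡-Reasoning

  -- a₀ and b₀ are junk values of to and from, needed only for empty lists.
  module _ (a₀ : A) (b₀ : B) where

    -- The recursive call on the outside of a ball keeps the radius; fuel ≥ length X makes it terminate.
    listIsometry : ∀ m fuel X Y → length X ≤ fuel → A.Diam≤ m X → B.Diam≤ m Y →
      SameSizes m X Y → length X ≡ length Y → ListIsometry X Y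
    listIsometry _ _ [] [] _ _ _ _ _ = record
      { to = λ _ → b₀ ; from = λ _ → a₀ ; to-∈ = λ () ; from-∈ = λ ()
      ; from-to = λ () ; to-from = λ () ; within-pres = λ () }
    listIsometry zero _ (x ∷ _) (y ∷ _) _ dX dY _ _ = record
      { to = λ _ → y ; from = λ _ → x ; to-∈ = λ _ → here ≡.refl ; from-∈ = λ _ → here ≡.refl
      ; from-to = λ w∈ → A.within-0⇒≡ (dX (here ≡.refl) w∈)
      ; to-from = λ z∈ → B.within-0⇒≡ (dY (here ≡.refl) z∈)
      ; within-pres = λ w∈ w'∈ i →
          mk⇔ (λ _ → B.within-≤ z≤n (B.within-refl 0)) (λ _ → A.within-≤ z≤n (dX w∈ w'∈)) }
    listIsometry (suc m) (suc fuel) X@(x ∷ _) Y@(y ∷ _) |X|≤ dX dY same |X|≡|Y| =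
      glue (A.within? m x) (B.within? m y) cross
        (listIsometry m (suc fuel) (A.ball m x X) (B.ball m y Y)
          (≤-trans (length-filter (A.within? m x) X) |X|≤)
          (A.diam≤-ball m x X) (B.diam≤-ball m y Y) (sameSizes-ball same) |ball|≡)
        (listIsometry (suc m) fuel (A.outside m x X) (B.outside m y Y)
          (≤-pred (≤-trans (A.length-outside< (here ≡.refl)) |X|≤))
          (A.diam≤-filter (∁? (A.within? m x)) dX) (B.diam≤-filter (∁? (B.within? m y)) dY)
          (sameSizes-outside same) |outside|≡)
      where
      cross : ∀ {w w' z z'} → w ∈ X → A.Within m x w → w' ∈ X → ¬ A.Within m x w' →
        z ∈ Y → B.Within m y z → z' ∈ Y → ¬ B.Within m y z' →
        ∀ i → A.Within i w w' ⇔ B.Within i z z'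
      cross w∈ xw w'∈ ¬xw' z∈ yz z'∈ ¬yz' i =
        ⇔.trans (A.across⇔< dX w∈ w'∈ xw ¬xw' i) (⇔.sym (B.across⇔< dY z∈ z'∈ yz ¬yz' i))
      |ball|≡ : length (A.ball m x X) ≡ length (B.ball m y Y)
      |ball|≡ = same m ≤-refl (here ≡.refl) (here ≡.refl)
      |outside|≡ : length (A.outside m x X) ≡ length (B.outside m y Y)
      |outside|≡ = +-cancelˡ-≡ (length (A.ball m x X)) _ _ (begin
        length (A.ball m x X) + length (A.outside m x X) ≡⟨ A.length-ball+outside m x X ⟩
        length X                                         ≡⟨ |X|≡|Y| ⟩
        length Y                                         ≡⟨ B.length-ball+outside m y Y ⟨
        length (B.ball m y Y) + length (B.outside m y Y) ≡⟨ ≡.cong (_+ _) |ball|≡ ⟨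
        length (A.ball m x X) + length (B.outside m y Y) ∎)
        where open ≡.≡-Reasoning

module _ {c ℓ} (G : Group c ℓ) where
  open Group G
  open GroupProperties G

  coset-isEquivalence : ∀ {q} {S : Pred Carrier q} → IsSubgroup G S → IsEquivalence (λ x y → S (x // y))
  coset-isEquivalence S≤G = record
    { refl  = λ {x} → resp (sym (x≈y⇒x∙y⁻¹≈ε refl)) ε∈
    ; sym   = λ {x} {y} s → resp (⁻¹-anti-homo-// x y) (⁻¹-closed s)
    ; trans = λ {x} {y} {z} s t → resp (//-trans x y z) (∙-closed s t)
    }
    where
    open IsSubgroup S≤G
    //-trans : ∀ x y z → (x // y) ∙ (y // z) ≈ x // z
    //-trans x y z = trans (sym (assoc (x // y) y (z ⁻¹))) (∙-congʳ (//-rightDividesˡ y x))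

  trivial-isSubgroup : IsSubgroup G (_≈ ε)
  trivial-isSubgroup = record
    { resp      = λ x≈y x≈ε → trans (sym x≈y) x≈ε
    ; ε∈        = refl
    ; ∙-closed  = λ x≈ε y≈ε → trans (∙-cong x≈ε y≈ε) (identityˡ ε)
    ; ⁻¹-closed = λ x≈ε → trans (⁻¹-cong x≈ε) ε⁻¹≈ε
    }

  Lift-isSubgroup : ∀ {q} r {S : Pred Carrier q} → IsSubgroup G S → IsSubgroup G (λ x → Lift r (S x))
  Lift-isSubgroup r S≤G = record
    { resp      = λ x≈y s → lift (resp x≈y (lower s))
    ; ε∈        = lift ε∈
    ; ∙-closed  = λ s t → lift (∙-closed (lower s) (lower t))
    ; ⁻¹-closed = λ s → lift (⁻¹-closed (lower s))
    }
    where open IsSubgroup S≤G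

  Lift-trivial-hasCard : ∀ r → HasCard G (λ x → Lift r (x ≈ ε)) 1
  Lift-trivial-hasCard r = record
    { to        = λ _ → ε , lift refl
    ; cong      = λ _ → refl
    ; bijective = (λ { {Fin.zero} {Fin.zero} _ → ≡.refl })
                , (λ x → Fin.zero , λ _ → sym (lower (proj₂ x)))
    }

  Lift-hasCard : ∀ {q} r {S : Pred Carrier q} {k} → HasCard G S k → HasCard G (λ x → Lift r (S x)) k
  Lift-hasCard r card = record
    { to        = λ c → proj₁ (to c) , lift (proj₂ (to c))
    ; cong      = cong
    ; bijective = injective , λ x → surjective (proj₁ x , lower (proj₂ x))
    }
    where open Bijection card

module FiniteGroup {c ℓ} (G : Group c ℓ) (fin : IsFinite G) where
  open Group G
  open GroupProperties G

  order : ℕ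
  order = proj₁ fin

  enumeration : Inverse (≡.setoid (Fin order)) setoid
  enumeration = Bijection⇒Inverse (proj₂ fin)

  open Inverse enumeration public
    using () renaming (to to enum; from to index; from-cong to index-cong;
                       strictlyInverseˡ to enum-index; strictlyInverseʳ to index-enum)

  enum-injective : ∀ {u v} → enum u ≈ enum v → u ≡ v
  enum-injective {u} {v} e = ≡.trans (≡.sym (index-enum u)) (≡.trans (index-cong e) (index-enum v))

  _≈?_ : ∀ x y → Dec (x ≈ y)
  _≈?_ = inj⇒≟ (Inverse⇒Injection (Symmetry.inverse enumeration))

  module _ {q} {S : Pred Carrier q} (S-resp : ∀ {x y} → x ≈ y → S x → S y)
           {k} (card : HasCard G S k) where
    private
      elem : Fin k → Carrier
      elem c = proj₁ (Bijection.to card c)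

    hasCard⇒decidable : Decidable S
    hasCard⇒decidable x = Dec.map (mk⇔ from-any to-any) (any? λ c → x ≈? elem c)
      where
      from-any : (∃ λ c → x ≈ elem c) → S x
      from-any (c , x≈) = S-resp (sym x≈) (proj₂ (Bijection.to card c))
      to-any : S x → ∃ λ c → x ≈ elem c
      to-any sx with c , e ← Bijection.strictlySurjective card (x , sx) = c , sym e

    length-coset : ∀ u → length (filter (λ v → hasCard⇒decidable (enum u // enum v)) (allFin order)) ≡ k
    length-coset u = length-filter-allFin _ φ φ-injective (mk⇔ in-image in-coset)
      where
      φ : Fin k → Fin order
      φ c = index (elem c \\ enum u)
      enum-u//φ : ∀ c → enum u // enum (φ c) ≈ elem c
      enum-u//φ c =
        trans (//-cong₂ refl (enum-index _)) (sym (x≈z//y _ _ _ (\\-leftDividesˡ (elem c) (enum u))))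
      φ-injective : Injective _≡_ _≡_ φ
      φ-injective {c} {c'} e = Bijection.injective card
        (trans (sym (enum-u//φ c)) (trans (//-cong₂ refl (reflexive (≡.cong enum e))) (enum-u//φ c')))
      in-coset : ∀ {v} → (∃ λ c → φ c ≡ v) → S (enum u // enum v)
      in-coset (c , ≡.refl) = S-resp (sym (enum-u//φ c)) (proj₂ (Bijection.to card c))
      in-image : ∀ {v} → S (enum u // enum v) → ∃ λ c → φ c ≡ v
      in-image {v} s with c , e ← Bijection.strictlySurjective card (enum u // enum v , s) =
        c , ≡.trans (index-cong (sym (y≈x\\z _ _ _ elem-c∙v≈u))) (index-enum v)
        where
        elem-c∙v≈u : elem c ∙ enum v ≈ enum u
        elem-c∙v≈u = trans (∙-congʳ e) (//-rightDividesˡ (enum v) (enum u))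

module ChainLevels {c ℓ p n} {G : Group c ℓ} (C : Chain G p (suc n)) where
  open Group G
  open GroupProperties G
  open Chain C

  Lvl-isSubgroup : ∀ i → i ≤ suc n → IsSubgroup G (Lvl i)
  Lvl-isSubgroup zero    _ = Lift-isSubgroup G p (trivial-isSubgroup G)
  Lvl-isSubgroup (suc i) i≤n = Lift-isSubgroup G ℓ (subgroup (suc i) (s≤s z≤n) i≤n)

  Lvl-suc : ∀ i → suc i ≤ suc n → Lvl i ⊆ Lvl (suc i)
  Lvl-suc zero    1≤n (lift z≈ε) = lift (resp (sym z≈ε) ε∈)
    where open IsSubgroup (subgroup 1 (s≤s z≤n) 1≤n)
  Lvl-suc (suc i) i<n (lift z∈H) = lift (incl (suc i) (s≤s z≤n) i<n z∈H)

  Lvl-mono : ∀ {i j} → i ≤ j → j ≤ suc n → Lvl i ⊆ Lvl j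
  Lvl-mono {i} i≤j = go (≤⇒≤′ i≤j)
    where
    go : ∀ {j} → i ≤′ j → j ≤ suc n → Lvl i ⊆ Lvl j
    go ≤′-refl        _   z∈ = z∈
    go (≤′-step i≤′j) j<n z∈ = Lvl-suc _ j<n (go i≤′j (≤-trans (n≤1+n _) j<n) z∈)

  -- Near j x y reads d_C(x, y) ≤ j; clamping the index at the top level makes it meaningful for every j.
  Near : ℕ → Rel Carrier (ℓ ⊔ p)
  Near j x y = Lvl (j ⊓ suc n) (x // y)

  Near-isEquivalence : ∀ j → IsEquivalence (Near j)
  Near-isEquivalence j = coset-isEquivalence G (Lvl-isSubgroup (j ⊓ suc n) (m⊓n≤n j (suc n)))

  Near-suc : ∀ j {x y} → Near j x y → Near (suc j) x y
  Near-suc j = Lvl-mono (⊓-monoˡ-≤ (suc n) (n≤1+n j)) (m⊓n≤n (suc j) (suc n))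

  Near-cong : ∀ j {x x' y y'} → x ≈ x' → y ≈ y' → Near j x y ⇔ Near j x' y'
  Near-cong j x≈x' y≈y' = mk⇔
    (λ near → N.trans (≈⇒Near (sym x≈x')) (N.trans near (≈⇒Near y≈y')))
    (λ near → N.trans (≈⇒Near x≈x') (N.trans near (≈⇒Near (sym y≈y'))))
    where
    module N = IsEquivalence (Near-isEquivalence j)
    open IsSubgroup (Lvl-isSubgroup (j ⊓ suc n) (m⊓n≤n j (suc n)))
    ≈⇒Near : ∀ {x y} → x ≈ y → Near j x y
    ≈⇒Near x≈y = resp (sym (x≈y⇒x∙y⁻¹≈ε x≈y)) ε∈

  Near⇔Lvl : ∀ {i} → i ≤ suc n → ∀ x y → Near i x y ⇔ Lvl i (x // y)
  Near⇔Lvl i≤n x y rewrite m≤n⇒m⊓n≡m i≤n = ⇔.refl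

module ChainTower {c ℓ p n} {G : Group c ℓ} (fin : IsFinite G) (C : Chain G p (suc n))
  (card : ∀ i → i ≤ suc n → ℕ) (hasCard : ∀ i i≤n → HasCard G (Chain.Lvl C i) (card i i≤n)) where
  open Group G
  open GroupProperties G
  open FiniteGroup G fin
  open ChainLevels C
  open Chain C using (Lvl; top)

  Near? : ∀ j x y → Dec (Near j x y)
  Near? j x y = hasCard⇒decidable (IsSubgroup.resp (Lvl-isSubgroup _ j⊓n≤n)) (hasCard _ j⊓n≤n) (x // y)
    where j⊓n≤n = m⊓n≤n j (suc n)

  tower : Tower (Fin order) (ℓ ⊔ p)
  tower = record
    { Within           = λ j u v → Near j (enum u) (enum v)
    ; isDecEquivalence = λ j → On.isDecEquivalence enum
                                 (record { isEquivalence = Near-isEquivalence j ; _≟_ = Near? j })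
    ; within-suc       = λ j → Near-suc j
    ; within-0⇒≡       = λ u~v → enum-injective (x∙y⁻¹≈ε⇒x≈y _ _ (lower u~v))
    }

  open TowerProperties tower using (size; Diam≤)

  size-allFin : ∀ j u → size j u (allFin order) ≡ card (j ⊓ suc n) (m⊓n≤n j (suc n))
  size-allFin j u = length-coset (IsSubgroup.resp (Lvl-isSubgroup _ j⊓n≤n)) (hasCard _ j⊓n≤n) u
    where j⊓n≤n = m⊓n≤n j (suc n)

  diam≤-allFin : Diam≤ (suc n) (allFin order)
  diam≤-allFin {u} {v} _ _ = Equivalence.from (Near⇔Lvl ≤-refl (enum u) (enum v)) (lift (top _))

module _ {c ℓ c' ℓ' p p' n} {G : Group c ℓ} {G' : Group c' ℓ'}
  (C : Chain G p (suc n)) (C' : Chain G' p' (suc n)) where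
  private
    module G = Group G
    module G' = Group G'
    module L = ChainLevels C
    module L' = ChainLevels C'

  near-pres⇒dist-pres : (F : G.Carrier → G'.Carrier) →
    (∀ j x y → L.Near j x y ⇔ L'.Near j (F x) (F y)) →
    ∀ x y i → Dist C x y i ⇔ Dist C' (F x) (F y) i
  near-pres⇒dist-pres F near-pres x y zero = near-pres 0 x y
  near-pres⇒dist-pres F near-pres x y (suc i) = mk⇔
    (λ (lift i<n , l , ¬l) → lift i<n , to (lvl-pres i<n) l , ¬l ∘ from (lvl-pres (<⇒≤ i<n)))
    (λ (lift i<n , l , ¬l) → lift i<n , from (lvl-pres i<n) l , ¬l ∘ to (lvl-pres (<⇒≤ i<n)))
    where
    open Equivalence
    lvl-pres : ∀ {j} → j ≤ suc n → Chain.Lvl C j (x G.// y) ⇔ Chain.Lvl C' j (F x G'.// F y)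
    lvl-pres j≤n =
      ⇔.trans (⇔.sym (L.Near⇔Lvl j≤n x y)) (⇔.trans (near-pres _ x y) (L'.Near⇔Lvl j≤n (F x) (F y)))

  module _ (fin : IsFinite G) (fin' : IsFinite G')
    (cards : ∀ i → i ≤ suc n →
               Σ ℕ λ k → HasCard G (Chain.Lvl C i) k × HasCard G' (Chain.Lvl C' i) k) where
    private
      module F = FiniteGroup G fin
      module F' = FiniteGroup G' fin'
      card : ∀ i → i ≤ suc n → ℕ
      card i i≤n = proj₁ (cards i i≤n)
      module T = ChainTower fin C card (λ i i≤n → proj₁ (proj₂ (cards i i≤n)))
      module T' = ChainTower fin' C' card (λ i i≤n → proj₂ (proj₂ (cards i i≤n)))
      module TP = TowerProperties T.tower
      module TP' = TowerProperties T'.tower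

    allFin-isometry : ListIsometry T.tower T'.tower (allFin F.order) (allFin F'.order)
    allFin-isometry =
      listIsometry T.tower T'.tower u₀ v₀ (suc n) (length (allFin F.order))
        (allFin F.order) (allFin F'.order) ≤-refl T.diam≤-allFin T'.diam≤-allFin same-sizes same-length
      where
      u₀ = F.index G.ε
      v₀ = F'.index G'.ε
      same-sizes : SameSizes T.tower T'.tower (suc n) (allFin F.order) (allFin F'.order)
      same-sizes j _ {u} {v} _ _ = ≡.trans (T.size-allFin j u) (≡.sym (T'.size-allFin j v))
      same-length : length (allFin F.order) ≡ length (allFin F'.order)
      same-length = begin
        length (allFin F.order)               ≡⟨ TP.size-diam≤ T.diam≤-allFin (∈-allFin u₀) ⟨
        TP.size (suc n) u₀ (allFin F.order)   ≡⟨ T.size-allFin (suc n) u₀ ⟩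
        card (suc n ⊓ suc n) _                ≡⟨ T'.size-allFin (suc n) v₀ ⟨
        TP'.size (suc n) v₀ (allFin F'.order) ≡⟨ TP'.size-diam≤ T'.diam≤-allFin (∈-allFin v₀) ⟩
        length (allFin F'.order)              ∎
        where open ≡.≡-Reasoning

    isometric : Isometric G G' C C'
    isometric = Inverse⇒Bijection inverse , near-pres⇒dist-pres (Inverse.to inverse) near-pres
      where
      open ListIsometry allFin-isometry
      Fin-inverse : Fin F.order ↔ Fin F'.order
      Fin-inverse = mk↔ₛ′ to from (λ v → to-from (∈-allFin v)) (λ u → from-to (∈-allFin u))
      inverse : Inverse G.setoid G'.setoid
      inverse = Composition.inverse (Symmetry.inverse F.enumeration)
                                    (Composition.inverse Fin-inverse F'.enumeration)
      near-pres : ∀ j x y → L.Near j x y ⇔ L'.Near j (Inverse.to inverse x) (Inverse.to inverse y)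
      near-pres j x y = ⇔.trans (L.Near-cong j (G.sym (F.enum-index x)) (G.sym (F.enum-index y)))
                                (within-pres (∈-allFin (F.index x)) (∈-allFin (F.index y)) j)

lemma7p6 : ∀ {c ℓ c' ℓ' p p' : Level} (n : ℕ)
    (G : Group c ℓ) (G' : Group c' ℓ')
    → IsFinite G → IsFinite G'
    → (C : Chain G p n) (C' : Chain G' p' n)
    → (∀ i → 1 ≤ i → i ≤ n →
    Σ ℕ λ k → HasCard G (Chain.H C i) k × HasCard G' (Chain.H C' i) k)
    → Isometric G G' C C'
lemma7p6 zero _ _ _ _ C _ _ with () ← Chain.1≤n C
lemma7p6 (suc n) G G' fin fin' C C' same = isometric C C' fin fin' levelCards
  where
  levelCards : ∀ i → i ≤ suc n →
    Σ ℕ λ k → HasCard G (Chain.Lvl C i) k × HasCard G' (Chain.Lvl C' i) k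
  levelCards zero    _   = 1 , Lift-trivial-hasCard G _ , Lift-trivial-hasCard G' _
  levelCards (suc i) i≤n with k , h , h' ← same (suc i) (s≤s z≤n) i≤n =
    k , Lift-hasCard G _ h , Lift-hasCard G' _ h'
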